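{- Let $m, n$ be integers with $m, n \geq 2$. Then $F(K_n \circ K_m) = nm + n - 2$.
   Context: All graphs are simple, finite and undirected; $K_k$ is the complete graph on $k$ vertices. The corona $G \circ H$ is the graph obtained from one copy of $G$ and $|V(G)|$ disjoint copies of $H$ by joining the $i$th vertex of $G$ to every vertex of the $i$th copy of $H$. Zero forcing: each vertex is blue or white; starting from an initial set $S$ of blue vertices, repeatedly apply the color-change rule: if a blue vertex $u$ has exactly one white neighbor $v$, color $v$ blue. $S$ is a zero forcing set if eventually all vertices are blue, and a failed zero forcing set otherwise. $F(G)$ denotes the maximum cardinality of a failed zero forcing set of $G$. -}

module Defs where

open import Data.Nat using (ℕ; _+_; _*_; _≤_)
open import Data.Bool using (Bool; true; false; not; _∧_)
open import Data.Fin using (Fin; splitAt; remQuot)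
open import Data.Fin.Properties using (_≟_)
open import Data.Fin.Subset using (Subset; _∈_; ∣_∣)
open import Data.Sum using (_⊎_; inj₁; inj₂)
open import Data.Product using (_×_; _,_; Σ)
open import Relation.Nullary using (¬_; yes; no)
open import Relation.Nullary.Decidable using (⌊_⌋)
open import Relation.Binary.PropositionalEquality using (_≡_; _≢_; refl; sym; cong; cong₂)
open import Data.Empty using (⊥-elim)
import Data.Sum as Sum

record Graph : Set where
  field
    order  : ℕ
    adj    : Fin order → Fin order → Bool
    adj-sym : ∀ u v → adj u v ≡ adj v u
    adj-irrefl : ∀ u → adj u u ≡ false

open Graph public

_==_ : ∀ {k} → Fin k → Fin k → Bool
i == j = ⌊ i ≟ j ⌋

==-sym : ∀ {k} (i j : Fin k) → (i == j) ≡ (j == i)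
==-sym i j with i ≟ j | j ≟ i
... | yes _ | yes _ = refl
... | no _  | no _  = refl
... | yes p | no q  = ⊥-elim (q (sym p))
... | no p  | yes q = ⊥-elim (p (sym q))

==-refl : ∀ {k} (i : Fin k) → (i == i) ≡ true
==-refl i with i ≟ i
... | yes _ = refl
... | no p  = ⊥-elim (p refl)

K : ℕ → Graph
K k = record
  { order = k
  ; adj    = λ i j → not (i == j)
  ; adj-sym = λ i j → cong not (==-sym i j)
  ; adj-irrefl = λ i → cong not (==-refl i)
  }

-- Corona G ∘ H.  Vertices are Fin (|G| + |G| * |H|); via splitAt and
-- remQuot a vertex is either inj₁ i (vertex i of G) or inj₂ (i , h)
-- (vertex h of the i-th copy of H).
module _ (G H : Graph) where
  private
    nG = order G
    nH = order H
    CV = Fin nG ⊎ (Fin nG × Fin nH)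

  coronaView : Fin (nG + nG * nH) → CV
  coronaView x = Sum.map₂ (remQuot {nG} nH) (splitAt nG x)

  cadj : CV → CV → Bool
  cadj (inj₁ a)       (inj₁ b)       = adj G a b
  cadj (inj₁ a)       (inj₂ (j , _)) = a == j
  cadj (inj₂ (i , _)) (inj₁ b)       = i == b
  cadj (inj₂ (i , h)) (inj₂ (j , k)) = (i == j) ∧ adj H h k

  cadj-sym : ∀ x y → cadj x y ≡ cadj y x
  cadj-sym (inj₁ a)       (inj₁ b)       = adj-sym G a b
  cadj-sym (inj₁ a)       (inj₂ (j , _)) = ==-sym a j
  cadj-sym (inj₂ (i , _)) (inj₁ b)       = ==-sym i b
  cadj-sym (inj₂ (i , h)) (inj₂ (j , k)) = cong₂ _∧_ (==-sym i j) (adj-sym H h k)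

  cadj-irrefl : ∀ x → cadj x x ≡ false
  cadj-irrefl (inj₁ a) = adj-irrefl G a
  cadj-irrefl (inj₂ (i , h)) rewrite ==-refl i = adj-irrefl H h

  corona : Graph
  corona = record
    { order = nG + nG * nH
    ; adj    = λ x y → cadj (coronaView x) (coronaView y)
    ; adj-sym = λ x y → cadj-sym (coronaView x) (coronaView y)
    ; adj-irrefl = λ x → cadj-irrefl (coronaView x)
    }

_∘ᶜ_ : Graph → Graph → Graph
G ∘ᶜ H = corona G H

-- Zero forcing: the set of vertices that eventually become blue from the
-- initial blue set S is the least set containing S and closed under the
-- color-change rule (blue u, every neighbour of u other than v blue ⇒ v blue).
data Blue (G : Graph) (S : Subset (order G)) : Fin (order G) → Set where
  initial : ∀ {v} → v ∈ S → Blue G S v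
  force   : ∀ {u v} → Blue G S u → adj G u v ≡ true
          → (∀ w → adj G u w ≡ true → w ≢ v → Blue G S w)
          → Blue G S v

IsZeroForcingSet : (G : Graph) → Subset (order G) → Set
IsZeroForcingSet G S = ∀ v → Blue G S v

IsFailedZeroForcingSet : (G : Graph) → Subset (order G) → Set
IsFailedZeroForcingSet G S = ¬ IsZeroForcingSet G S

IsMaxFailedZeroForcingSize : (G : Graph) → ℕ → Set
IsMaxFailedZeroForcingSize G k =
  Σ (Subset (order G)) (λ S → IsFailedZeroForcingSet G S × ∣ S ∣ ≡ k)
  × (∀ S → IsFailedZeroForcingSet G S → ∣ S ∣ ≤ k)

-- A set missing at most one vertex of a graph without isolated vertices is
-- zero forcing: each missing vertex is the only white neighbour of any of its
-- neighbours.  Hence a failed set misses two vertices and has size at most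
-- |V| − 2.  Conversely, if a and b are twins (every other vertex sees both or
-- neither), then a blue vertex adjacent to one of them has the other as a
-- second white neighbour, so V ∖ {a, b} is failed.  In K_n ∘ K_m, two leaves
-- of the same copy of K_m are twins and no vertex is isolated.
module Submission where

open import Defs
open import Data.Nat using (ℕ; suc; _+_; _*_; _∸_; _≤_; s≤s; _≤?_)
open import Data.Nat.Properties using (+-comm)
open import Data.Bool using (true)
open import Data.Fin using (Fin; zero; suc; splitAt; remQuot; combine; join)
open import Data.Fin.Properties
  using (_≟_; splitAt-join; join-splitAt; remQuot-combine; combine-remQuot)
open import Data.Fin.Subset using (Subset; _∈_; _∉_; _⊆_; ∣_∣; ⁅_⁆; _∪_; ∁)
open import Data.Fin.Subset.Properties
  using (_∈?_; x∈⁅x⁆; x∈⁅y⁆⇒x≡y; ∣⁅x⁆∣≡1; x∈p∪q⁺; x∈p∪q⁻; ∪-identityˡ; ∪-identityʳ;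
         x∉p⇒x∈∁p; x∈p⇒x∉∁p; ∣∁p∣≡n∸∣p∣; p⊆q⇒∣p∣≤∣q∣)
open import Data.Sum using (_⊎_; inj₁; inj₂)
import Data.Sum as Sum
open import Data.Product using (_×_; _,_; ∃; uncurry)
open import Relation.Nullary using (¬_; yes; no)
open import Relation.Binary.PropositionalEquality
  using (_≡_; _≢_; refl; sym; trans; cong; subst; ≢-sym)
open import Data.Empty using (⊥-elim)

∣⁅x⁆∪⁅y⁆∣≡2 : ∀ {N} {x y : Fin N} → x ≢ y → ∣ ⁅ x ⁆ ∪ ⁅ y ⁆ ∣ ≡ 2
∣⁅x⁆∪⁅y⁆∣≡2 {x = zero}  {zero}  x≢y = ⊥-elim (x≢y refl)
∣⁅x⁆∪⁅y⁆∣≡2 {x = zero}  {suc y} _   = cong suc (trans (cong ∣_∣ (∪-identityˡ ⁅ y ⁆)) (∣⁅x⁆∣≡1 y))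
∣⁅x⁆∪⁅y⁆∣≡2 {x = suc x} {zero}  _   = cong suc (trans (cong ∣_∣ (∪-identityʳ ⁅ x ⁆)) (∣⁅x⁆∣≡1 x))
∣⁅x⁆∪⁅y⁆∣≡2 {x = suc x} {suc y} x≢y = ∣⁅x⁆∪⁅y⁆∣≡2 (λ x≡y → x≢y (cong suc x≡y))

x∈⁅x⁆∪⁅y⁆ : ∀ {N} (x y : Fin N) → x ∈ (⁅ x ⁆ ∪ ⁅ y ⁆)
x∈⁅x⁆∪⁅y⁆ x y = x∈p∪q⁺ (inj₁ (x∈⁅x⁆ x))

y∈⁅x⁆∪⁅y⁆ : ∀ {N} (x y : Fin N) → y ∈ (⁅ x ⁆ ∪ ⁅ y ⁆)
y∈⁅x⁆∪⁅y⁆ x y = x∈p∪q⁺ (inj₂ (x∈⁅x⁆ y))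

p⊆∁⁅x⁆∪⁅y⁆ : ∀ {N} {p : Subset N} {x y} → x ∉ p → y ∉ p → p ⊆ ∁ (⁅ x ⁆ ∪ ⁅ y ⁆)
p⊆∁⁅x⁆∪⁅y⁆ {p = p} {x} {y} x∉p y∉p {z} z∈p = x∉p⇒x∈∁p z∉⁅x⁆∪⁅y⁆
  where
  z∉⁅x⁆∪⁅y⁆ : z ∉ (⁅ x ⁆ ∪ ⁅ y ⁆)
  z∉⁅x⁆∪⁅y⁆ z∈⁅x⁆∪⁅y⁆ with x∈p∪q⁻ ⁅ x ⁆ ⁅ y ⁆ z∈⁅x⁆∪⁅y⁆
  ... | inj₁ z∈⁅x⁆ = x∉p (subst (_∈ p) (x∈⁅y⁆⇒x≡y x z∈⁅x⁆) z∈p)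
  ... | inj₂ z∈⁅y⁆ = y∉p (subst (_∈ p) (x∈⁅y⁆⇒x≡y y z∈⁅y⁆) z∈p)

∣∁⁅x⁆∪⁅y⁆∣≡n∸2 : ∀ {N} {x y : Fin N} → x ≢ y → ∣ ∁ (⁅ x ⁆ ∪ ⁅ y ⁆) ∣ ≡ N ∸ 2
∣∁⁅x⁆∪⁅y⁆∣≡n∸2 {N} {x} {y} x≢y =
  trans (∣∁p∣≡n∸∣p∣ (⁅ x ⁆ ∪ ⁅ y ⁆)) (cong (N ∸_) (∣⁅x⁆∪⁅y⁆∣≡2 x≢y))

two∉⇒∣p∣≤n∸2 : ∀ {N} {p : Subset N} {x y} → x ≢ y → x ∉ p → y ∉ p → ∣ p ∣ ≤ N ∸ 2
two∉⇒∣p∣≤n∸2 x≢y x∉p y∉p =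
  subst (_ ≤_) (∣∁⁅x⁆∪⁅y⁆∣≡n∸2 x≢y) (p⊆q⇒∣p∣≤∣q∣ (p⊆∁⁅x⁆∪⁅y⁆ x∉p y∉p))

module _ {G : Graph} where

  adj⇒≢ : ∀ {u v} → adj G u v ≡ true → u ≢ v
  adj⇒≢ {u} u~u refl with trans (sym u~u) (adj-irrefl G u)
  ... | ()

  NoIsolatedVertex : Set
  NoIsolatedVertex = ∀ v → ∃ λ u → adj G v u ≡ true

  AtMostOneOutside : Subset (order G) → Set
  AtMostOneOutside S = ∀ {v w} → v ∉ S → w ∉ S → v ≡ w

  atMostOneOutside⇒zeroForcing :
    NoIsolatedVertex → ∀ {S} → AtMostOneOutside S → IsZeroForcingSet G S
  atMostOneOutside⇒zeroForcing noIsolated {S} atMostOne v with v ∈? S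
  ... | yes v∈S = initial v∈S
  ... | no v∉S with noIsolated v
  ... | u , v~u =
    force (initial (inS (≢-sym (adj⇒≢ v~u)))) (trans (adj-sym G u v) v~u)
          (λ w _ w≢v → initial (inS w≢v))
    where
    inS : ∀ {w} → w ≢ v → w ∈ S
    inS {w} w≢v with w ∈? S
    ... | yes w∈S = w∈S
    ... | no w∉S = ⊥-elim (w≢v (atMostOne w∉S v∉S))

  failed⇒∣S∣≤n∸2 :
    NoIsolatedVertex → ∀ {S} → IsFailedZeroForcingSet G S → ∣ S ∣ ≤ order G ∸ 2
  failed⇒∣S∣≤n∸2 noIsolated {S} failed with ∣ S ∣ ≤? order G ∸ 2
  ... | yes ∣S∣≤n∸2 = ∣S∣≤n∸2
  ... | no ∣S∣≰n∸2 = ⊥-elim (failed (atMostOneOutside⇒zeroForcing noIsolated atMostOne))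
    where
    atMostOne : AtMostOneOutside S
    atMostOne {v} {w} v∉S w∉S with v ≟ w
    ... | yes v≡w = v≡w
    ... | no v≢w = ⊥-elim (∣S∣≰n∸2 (two∉⇒∣p∣≤n∸2 v≢w v∉S w∉S))

  Twins : Fin (order G) → Fin (order G) → Set
  Twins a b = ∀ u → u ≢ a → u ≢ b → adj G u a ≡ adj G u b

  twins-sym : ∀ {a b} → Twins a b → Twins b a
  twins-sym twins u u≢b u≢a = sym (twins u u≢a u≢b)

  -- Whichever of a, b would turn blue first needs the other to be blue already.
  twins-unforced : ∀ {a b S} → Twins a b → a ≢ b → a ∉ S → b ∉ S → ¬ Blue G S a
  twins-unforced twins a≢b a∉S b∉S (initial a∈S) = a∉S a∈S
  twins-unforced {a} {b} twins a≢b a∉S b∉S (force {u} blue-u u~a others) with u ≟ b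
  ... | yes refl = twins-unforced (twins-sym twins) (≢-sym a≢b) b∉S a∉S blue-u
  ... | no u≢b   = twins-unforced (twins-sym twins) (≢-sym a≢b) b∉S a∉S
                     (others b u~b (≢-sym a≢b))
    where
    u~b : adj G u b ≡ true
    u~b = trans (sym (twins u (adj⇒≢ u~a) u≢b)) u~a

  twins⇒∁⁅a⁆∪⁅b⁆-failed : ∀ {a b} → Twins a b → a ≢ b
    → IsFailedZeroForcingSet G (∁ (⁅ a ⁆ ∪ ⁅ b ⁆))
  twins⇒∁⁅a⁆∪⁅b⁆-failed {a} {b} twins a≢b allBlue =
    twins-unforced twins a≢b (x∈p⇒x∉∁p (x∈⁅x⁆∪⁅y⁆ a b)) (x∈p⇒x∉∁p (y∈⁅x⁆∪⁅y⁆ a b))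
      (allBlue a)

  twins⇒maxFailedSize : NoIsolatedVertex → ∀ {a b} → Twins a b → a ≢ b
    → IsMaxFailedZeroForcingSize G (order G ∸ 2)
  twins⇒maxFailedSize noIsolated {a} {b} twins a≢b =
    (∁ (⁅ a ⁆ ∪ ⁅ b ⁆) , twins⇒∁⁅a⁆∪⁅b⁆-failed twins a≢b , ∣∁⁅x⁆∪⁅y⁆∣≡n∸2 a≢b)
    , λ S → failed⇒∣S∣≤n∸2 noIsolated

module _ (G H : Graph) where

  private
    nG = order G
    nH = order H
    view = coronaView G H

  coronaVertex : Fin nG ⊎ (Fin nG × Fin nH) → Fin (order (G ∘ᶜ H))
  coronaVertex c = join nG (nG * nH) (Sum.map₂ (uncurry combine) c)

  coronaView-coronaVertex : ∀ c → view (coronaVertex c) ≡ c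
  coronaView-coronaVertex (inj₁ i) =
    cong (Sum.map₂ (remQuot nH)) (splitAt-join nG (nG * nH) (inj₁ i))
  coronaView-coronaVertex (inj₂ (i , h)) =
    trans (cong (Sum.map₂ (remQuot nH)) (splitAt-join nG (nG * nH) (inj₂ (combine i h))))
          (cong inj₂ (remQuot-combine i h))

  coronaVertex-coronaView : ∀ x → coronaVertex (view x) ≡ x
  coronaVertex-coronaView x =
    trans (cong (join nG (nG * nH)) (combine∘remQuot (splitAt nG x)))
          (join-splitAt nG (nG * nH) x)
    where
    combine∘remQuot : ∀ y → Sum.map₂ (uncurry combine) (Sum.map₂ (remQuot {nG} nH) y) ≡ y
    combine∘remQuot (inj₁ i) = refl
    combine∘remQuot (inj₂ j) = cong inj₂ (combine-remQuot {nG} nH j)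

  coronaVertex-injective : ∀ c d → coronaVertex c ≡ coronaVertex d → c ≡ d
  coronaVertex-injective c d e =
    trans (sym (coronaView-coronaVertex c)) (trans (cong view e) (coronaView-coronaVertex d))

  coronaView≡⇒≡coronaVertex : ∀ {x c} → view x ≡ c → x ≡ coronaVertex c
  coronaView≡⇒≡coronaVertex {x} refl = sym (coronaVertex-coronaView x)

  adj-coronaVertex : ∀ x c → adj (G ∘ᶜ H) x (coronaVertex c) ≡ cadj G H (view x) c
  adj-coronaVertex x c = cong (cadj G H (view x)) (coronaView-coronaVertex c)

  corona-noIsolatedVertex : Fin nH → NoIsolatedVertex {G ∘ᶜ H}
  corona-noIsolatedVertex h₀ x =
    coronaVertex (partner (view x)) , trans (adj-coronaVertex x _) (cadj-partner (view x))
    where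
    partner : Fin nG ⊎ (Fin nG × Fin nH) → Fin nG ⊎ (Fin nG × Fin nH)
    partner (inj₁ i) = inj₂ (i , h₀)
    partner (inj₂ (i , _)) = inj₁ i

    cadj-partner : ∀ c → cadj G H c (partner c) ≡ true
    cadj-partner (inj₁ i) = ==-refl i
    cadj-partner (inj₂ (i , _)) = ==-refl i

module _ (G : Graph) {m : ℕ} where

  corona-K-leaves-twins : ∀ i {h h′}
    → Twins {G ∘ᶜ K m} (coronaVertex G (K m) (inj₂ (i , h))) (coronaVertex G (K m) (inj₂ (i , h′)))
  corona-K-leaves-twins i {h} {h′} u u≢a u≢b =
    trans (adj-coronaVertex G (K m) u (inj₂ (i , h)))
      (trans (cadj-leaves (coronaView G (K m) u)
                (λ e → u≢a (coronaView≡⇒≡coronaVertex G (K m) e))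
                (λ e → u≢b (coronaView≡⇒≡coronaVertex G (K m) e)))
             (sym (adj-coronaVertex G (K m) u (inj₂ (i , h′)))))
    where
    cadj-leaves : ∀ c → c ≢ inj₂ (i , h) → c ≢ inj₂ (i , h′)
      → cadj G (K m) c (inj₂ (i , h)) ≡ cadj G (K m) c (inj₂ (i , h′))
    cadj-leaves (inj₁ j) _ _ = refl
    cadj-leaves (inj₂ (j , k)) c≢a c≢b with j ≟ i
    ... | no _ = refl
    ... | yes refl with k ≟ h | k ≟ h′
    ... | yes refl | _        = ⊥-elim (c≢a refl)
    ... | no _     | yes refl = ⊥-elim (c≢b refl)
    ... | no _     | no _     = refl

corollary3p20 : (m n : ℕ) → 2 ≤ m → 2 ≤ n
    → IsMaxFailedZeroForcingSize (K n ∘ᶜ K m) (n * m + n ∸ 2)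
corollary3p20 m n (s≤s (s≤s _)) (s≤s _) =
  subst (IsMaxFailedZeroForcingSize (K n ∘ᶜ K m)) (cong (_∸ 2) (+-comm n (n * m)))
    (twins⇒maxFailedSize (corona-noIsolatedVertex (K n) (K m) zero)
      (corona-K-leaves-twins (K n) zero) leaf₀≢leaf₁)
  where
  leaf : Fin m → Fin n ⊎ (Fin n × Fin m)
  leaf h = inj₂ (zero , h)

  leaf₀≢leaf₁ : coronaVertex (K n) (K m) (leaf zero) ≢ coronaVertex (K n) (K m) (leaf (suc zero))
  leaf₀≢leaf₁ e with coronaVertex-injective (K n) (K m) (leaf zero) (leaf (suc zero)) e
  ... | ()
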